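{- Let $m,n\ge1$ and let $(u_{i,j})$ be a positive integral $(m,n)$-periodic $SL_2$-tiling. For $i_0,j_0\in\mathbb Z$ define $$a_i=\frac{u_{i-1,j_0}+u_{i+1,j_0}}{u_{i,j_0}},\qquad b_j=\frac{u_{i_0,j-1}+u_{i_0,j+1}}{u_{i_0,j}}\qquad(i,j\in\mathbb Z).$$ Then $(a_i)$ and $(b_j)$ are quiddity sequences of positive integral infinite periodic frieze patterns with periods $m$ and $n$ respectively, and these patterns do not depend on the choice of $i_0,j_0$.
   Context: An $SL_2$-tiling is a family $(u_{i,j})_{i,j\in\mathbb Z}$ of reals with $u_{i+1,j}u_{i,j+1}-u_{i,j}u_{i+1,j+1}=1$ for all $i,j$; positive integral if all entries are positive integers; $(m,n)$-periodic if $u_{i+m,j+n}=u_{i,j}$ for all $i,j$. An infinite frieze pattern is a family $(v_{k,l})_{k,l\in\mathbb Z,\ l\ge k}$ with $v_{k,k}=0$, $v_{k,k+1}=1$ and $v_{k,l}v_{k+1,l+1}-v_{k,l+1}v_{k+1,l}=1$ whenever defined; its quiddity sequence is the row $(v_{k,k+2})_k$, which determines the pattern. It is positive integral if $v_{k,l}$ is a positive integer for all $l>k$, and $p$-periodic if $v_{k+p,l+p}=v_{k,l}$ for all $k,l$. A sequence $(c_k)$ is the quiddity sequence of a pattern if $v_{k-1,k+1}=c_k$ for all $k$. -}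

module Defs where

open import Data.Nat using (ℕ)
open import Data.Integer using (ℤ; +_; _+_; _-_; _*_; _<_; _≤_; 0ℤ; 1ℤ)
open import Relation.Binary.PropositionalEquality using (_≡_)
open import Data.Product using (_×_)

IsSL2Tiling : (ℤ → ℤ → ℤ) → Set
IsSL2Tiling u = ∀ i j →
  u (i + 1ℤ) j * u i (j + 1ℤ) - u i j * u (i + 1ℤ) (j + 1ℤ) ≡ 1ℤ

TilingPositiveIntegral : (ℤ → ℤ → ℤ) → Set
TilingPositiveIntegral u = ∀ i j → 0ℤ < u i j

TilingPeriodic : ℕ → ℕ → (ℤ → ℤ → ℤ) → Set
TilingPeriodic m n u = ∀ i j → u (i + + m) (j + + n) ≡ u i j

-- An infinite frieze pattern: v k l = v_{k,l}; only the values with l ≥ k matter.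
record IsInfiniteFrieze (v : ℤ → ℤ → ℤ) : Set where
  field
    diag0 : ∀ k → v k k ≡ 0ℤ
    diag1 : ∀ k → v k (k + 1ℤ) ≡ 1ℤ
    -- diamond rule, whenever all entries are defined (i.e. l ≥ k + 1)
    unimod : ∀ k l → k + 1ℤ ≤ l →
      v k l * v (k + 1ℤ) (l + 1ℤ) - v k (l + 1ℤ) * v (k + 1ℤ) l ≡ 1ℤ

FriezePositiveIntegral : (ℤ → ℤ → ℤ) → Set
FriezePositiveIntegral v = ∀ k l → k < l → 0ℤ < v k l

FriezePeriodic : ℕ → (ℤ → ℤ → ℤ) → Set
FriezePeriodic p v = ∀ k l → k ≤ l → v (k + + p) (l + + p) ≡ v k l

{-# OPTIONS --safe #-}
module Submission where

-- Fix two adjacent columns x = u₍·,c₎ and y = u₍·,c+1₎ of the tiling and let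
-- v k l = y k * x l - x k * y l be their 2×2 minors.  The SL₂ rule says v k (k+1) = 1,
-- and the Plücker relations then make v an infinite frieze.  The three-term relation
-- x k * v j l = x j * v k l + x l * v j k yields positivity (induction on l) and the
-- recurrence v (i-1) (i+1) * x i = x (i-1) + x (i+1), which holds for y as well.
-- Comparing the recurrences of the column pairs (c, c+1) and (c+1, c+2) and cancelling
-- u₍i,c+1₎ > 0 shows that the coefficient does not depend on c.  Transposing, every
-- column is a fixed linear combination of the two preceding ones, so the minors do not
-- depend on c either; (m,n)-periodicity of u then gives m-periodicity of v.

open import Defs
open import Data.Nat using (ℕ; NonZero; zero; suc; z<s)
import Data.Nat.Properties as ℕ
open import Data.Integer using (ℤ; +_; +[1+_]; -[1+_]; _+_; _-_; _*_; _<_; 0ℤ; 1ℤ; +<+; ∣_∣)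
open import Data.Integer.Properties
open import Data.Integer.Tactic.RingSolver using (solve-∀)
open import Data.Product using (_×_; ∃; _,_)
open import Function using (flip)
open import Relation.Binary.PropositionalEquality

pos+pos⇒pos : ∀ {i j} → 0ℤ < i → 0ℤ < j → 0ℤ < i + j
pos+pos⇒pos {+[1+ _ ]} {+[1+ _ ]} _ _ = +<+ z<s
pos+pos⇒pos {+ zero} (+<+ ())
pos+pos⇒pos {+[1+ _ ]} {+ zero} _ (+<+ ())

pos*pos⇒pos : ∀ {i j} → 0ℤ < i → 0ℤ < j → 0ℤ < i * j
pos*pos⇒pos {+[1+ _ ]} {+[1+ _ ]} _ _ = +<+ z<s
pos*pos⇒pos {+ zero} (+<+ ())
pos*pos⇒pos {+[1+ _ ]} {+ zero} _ (+<+ ())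

*-cancelʳ-pos : ∀ {i j} → 0ℤ < j → 0ℤ < i * j → 0ℤ < i
*-cancelʳ-pos {i} {+[1+ n ]} _ 0<ij =
  *-cancelʳ-<-nonNeg +[1+ n ] (subst (_< i * +[1+ n ]) (sym (*-zeroˡ +[1+ n ])) 0<ij)
*-cancelʳ-pos {j = + zero} (+<+ ())

*-cancelʳ-≡-pos : ∀ i j {k} → 0ℤ < k → i * k ≡ j * k → i ≡ j
*-cancelʳ-≡-pos i j {+[1+ n ]} _ = *-cancelʳ-≡ i j +[1+ n ]
*-cancelʳ-≡-pos i j {+ zero} (+<+ ())

step-invariant⇒constant : ∀ {a} {A : Set a} (f : ℤ → A) →
  (∀ c → f (c + 1ℤ) ≡ f c) → ∀ c c′ → f c ≡ f c′
step-invariant⇒constant f step c c′ = trans (to-zero c) (sym (to-zero c′))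
  where
  to-zero : ∀ c → f c ≡ f 0ℤ
  to-zero (+ zero)        = refl
  to-zero (+ suc n)       = trans (cong (λ k → f (+ k)) (ℕ.+-comm 1 n)) (trans (step (+ n)) (to-zero (+ n)))
  to-zero -[1+ zero ]     = sym (step -[1+ zero ])
  to-zero -[1+ suc n ]    = trans (sym (step -[1+ suc n ])) (to-zero -[1+ n ])

induction-above : ∀ {p} (P : ℤ → Set p) k → P (k + 1ℤ) → (∀ l → P l → P (l + 1ℤ)) →
  ∀ l → k < l → P l
induction-above P k base step l k<l = subst P (k+[1+d]≡l l k<l) (from-offset ∣ l - (1ℤ + k) ∣)
  where
  from-offset : ∀ d → P (k + +[1+ d ])
  from-offset zero    = base
  from-offset (suc d) = subst P (trans (+-assoc k +[1+ d ] 1ℤ) (cong (λ e → k + + e) (ℕ.+-comm (suc d) 1)))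
                              (step _ (from-offset d))
  k+[1+d]≡l : ∀ l → k < l → k + +[1+ ∣ l - (1ℤ + k) ∣ ] ≡ l
  k+[1+d]≡l l k<l = begin
    k + (1ℤ + + ∣ l - (1ℤ + k) ∣) ≡⟨ cong (λ e → k + (1ℤ + e)) (0≤i⇒+∣i∣≡i (i≤j⇒0≤j-i (i<j⇒suc[i]≤j k<l))) ⟩
    k + (1ℤ + (l - (1ℤ + k)))    ≡⟨ cancel k l ⟩
    l                            ∎
    where
    open ≡-Reasoning
    cancel : ∀ k l → k + (1ℤ + (l - (1ℤ + k))) ≡ l
    cancel = solve-∀

minor : (ℤ → ℤ) → (ℤ → ℤ) → ℤ → ℤ → ℤ
minor x y k l = y k * x l - x k * y l

record Unimodular (x y : ℤ → ℤ) : Set where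
  field adjacent-minor : ∀ k → minor x y k (k + 1ℤ) ≡ 1ℤ

minor-diagonal : ∀ x y k → minor x y k k ≡ 0ℤ
minor-diagonal x y k = identity (x k) (y k)
  where
  identity : ∀ a b → b * a - a * b ≡ 0ℤ
  identity = solve-∀

minor-plücker : ∀ x y k k′ l l′ →
  minor x y k l * minor x y k′ l′ - minor x y k l′ * minor x y k′ l ≡ minor x y k k′ * minor x y l l′
minor-plücker x y k k′ l l′ = identity (x k) (y k) (x k′) (y k′) (x l) (y l) (x l′) (y l′)
  where
  identity : ∀ a b a′ b′ c d c′ d′ →
    (b * c - a * d) * (b′ * c′ - a′ * d′) - (b * c′ - a * d′) * (b′ * c - a′ * d) ≡
    (b * a′ - a * b′) * (d * c′ - c * d′)
  identity = solve-∀

minor-three-termˣ : ∀ x y j k l → minor x y j l * x k ≡ x j * minor x y k l + x l * minor x y j k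
minor-three-termˣ x y j k l = identity (x j) (y j) (x k) (y k) (x l) (y l)
  where
  identity : ∀ a b c d e f → (b * e - a * f) * c ≡ a * (d * e - c * f) + e * (b * c - a * d)
  identity = solve-∀

minor-three-termʸ : ∀ x y j k l → minor x y j l * y k ≡ y j * minor x y k l + y l * minor x y j k
minor-three-termʸ x y j k l = identity (x j) (y j) (x k) (y k) (x l) (y l)
  where
  identity : ∀ a b c d e f → (b * e - a * f) * d ≡ b * (d * e - c * f) + f * (b * c - a * d)
  identity = solve-∀

module _ {x y : ℤ → ℤ} (unimodular : Unimodular x y) where

  open Unimodular unimodular

  minor-isInfiniteFrieze : IsInfiniteFrieze (minor x y)
  minor-isInfiniteFrieze = record
    { diag0  = minor-diagonal x y
    ; diag1  = adjacent-minor
    ; unimod = λ k l _ → begin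
        minor x y k l * minor x y (k + 1ℤ) (l + 1ℤ) - minor x y k (l + 1ℤ) * minor x y (k + 1ℤ) l
          ≡⟨ minor-plücker x y k (k + 1ℤ) l (l + 1ℤ) ⟩
        minor x y k (k + 1ℤ) * minor x y l (l + 1ℤ)
          ≡⟨ cong₂ _*_ (adjacent-minor k) (adjacent-minor l) ⟩
        1ℤ ∎
    }
    where open ≡-Reasoning

  private
    adjacent-minor′ : ∀ i → minor x y (i - 1ℤ) i ≡ 1ℤ
    adjacent-minor′ i = subst (λ k → minor x y (i - 1ℤ) k ≡ 1ℤ) (i-1+1≡i i) (adjacent-minor (i - 1ℤ))
      where
      i-1+1≡i : ∀ i → i - 1ℤ + 1ℤ ≡ i
      i-1+1≡i = solve-∀

    sum-of-unit-multiples : ∀ a b {p q} → p ≡ 1ℤ → q ≡ 1ℤ → a * p + b * q ≡ a + b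
    sum-of-unit-multiples a b refl refl = cong₂ _+_ (*-identityʳ a) (*-identityʳ b)

  minor-recurrenceˣ : ∀ i → minor x y (i - 1ℤ) (i + 1ℤ) * x i ≡ x (i - 1ℤ) + x (i + 1ℤ)
  minor-recurrenceˣ i = trans (minor-three-termˣ x y (i - 1ℤ) i (i + 1ℤ))
                              (sum-of-unit-multiples (x (i - 1ℤ)) (x (i + 1ℤ)) (adjacent-minor i) (adjacent-minor′ i))

  minor-recurrenceʸ : ∀ i → minor x y (i - 1ℤ) (i + 1ℤ) * y i ≡ y (i - 1ℤ) + y (i + 1ℤ)
  minor-recurrenceʸ i = trans (minor-three-termʸ x y (i - 1ℤ) i (i + 1ℤ))
                              (sum-of-unit-multiples (y (i - 1ℤ)) (y (i + 1ℤ)) (adjacent-minor i) (adjacent-minor′ i))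

  minor-positive : (∀ k → 0ℤ < x k) → FriezePositiveIntegral (minor x y)
  minor-positive x-pos k = induction-above (λ l → 0ℤ < minor x y k l) k (unit-pos (adjacent-minor k)) step
    where
    unit-pos : ∀ {v} → v ≡ 1ℤ → 0ℤ < v
    unit-pos refl = +<+ z<s
    step : ∀ l → 0ℤ < minor x y k l → 0ℤ < minor x y k (l + 1ℤ)
    step l 0<v[k,l] = *-cancelʳ-pos (x-pos l) (subst (0ℤ <_) (sym (minor-three-termˣ x y k l (l + 1ℤ)))
      (pos+pos⇒pos (pos*pos⇒pos (x-pos k) (unit-pos (adjacent-minor l)))
                   (pos*pos⇒pos (x-pos (l + 1ℤ)) 0<v[k,l])))

minor-shift : ∀ {x y z} b → (∀ i → b * y i ≡ x i + z i) → ∀ k l → minor y z k l ≡ minor x y k l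
minor-shift {x} {y} {z} b z≡b*y-x k l = begin
  minor y z k l
    ≡⟨ split (x k) (y k) (z k) (x l) (y l) (z l) ⟩
  minor x y k l + ((x k + z k) * y l - y k * (x l + z l))
    ≡⟨ cong₂ (λ p q → minor x y k l + (p * y l - y k * q)) (sym (z≡b*y-x k)) (sym (z≡b*y-x l)) ⟩
  minor x y k l + ((b * y k) * y l - y k * (b * y l))
    ≡⟨ cong (_+_ (minor x y k l)) (cancel b (y k) (y l)) ⟩
  minor x y k l + 0ℤ
    ≡⟨ +-identityʳ _ ⟩
  minor x y k l ∎
  where
  open ≡-Reasoning
  split : ∀ a b c a′ b′ c′ → c * b′ - b * c′ ≡ (b * a′ - a * b′) + ((a + c) * b′ - b * (a′ + c′))
  split = solve-∀
  cancel : ∀ b p q → (b * p) * q - p * (b * q) ≡ 0ℤ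
  cancel = solve-∀

columnMinor : (ℤ → ℤ → ℤ) → ℤ → ℤ → ℤ → ℤ
columnMinor u c = minor (flip u c) (flip u (c + 1ℤ))

flip-isSL2Tiling : ∀ u → IsSL2Tiling u → IsSL2Tiling (flip u)
flip-isSL2Tiling u tiling i j =
  trans (cong (_- u j i * u (j + 1ℤ) (i + 1ℤ)) (*-comm (u j (i + 1ℤ)) (u (j + 1ℤ) i))) (tiling j i)

adjacent-columns-unimodular : ∀ u → IsSL2Tiling u → ∀ c → Unimodular (flip u c) (flip u (c + 1ℤ))
adjacent-columns-unimodular u tiling c .Unimodular.adjacent-minor k =
  trans (cong (_- u k c * u (k + 1ℤ) (c + 1ℤ)) (*-comm (u k (c + 1ℤ)) (u (k + 1ℤ) c))) (tiling k c)

columnMinor-periodic : ∀ {m n u} → TilingPeriodic m n u →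
  ∀ c k l → columnMinor u (c + + n) (k + + m) (l + + m) ≡ columnMinor u c k l
columnMinor-periodic {m} {n} {u} periodic c k l =
  cong₂ _-_ (cong₂ _*_ (next-column k) (periodic l c)) (cong₂ _*_ (periodic k c) (next-column l))
  where
  next-column : ∀ i → u (i + + m) (c + + n + 1ℤ) ≡ u i (c + 1ℤ)
  next-column i = trans (cong (u (i + + m)) (reorder c (+ n))) (periodic i (c + 1ℤ))
    where
    reorder : ∀ c e → c + e + 1ℤ ≡ c + 1ℤ + e
    reorder = solve-∀

module _ (u : ℤ → ℤ → ℤ) (tiling : IsSL2Tiling u) (positive : TilingPositiveIntegral u) where

  private
    coefficient-step : ∀ c i → columnMinor u (c + 1ℤ) (i - 1ℤ) (i + 1ℤ) ≡ columnMinor u c (i - 1ℤ) (i + 1ℤ)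
    coefficient-step c i = *-cancelʳ-≡-pos _ _ (positive i (c + 1ℤ))
      (trans (minor-recurrenceˣ (adjacent-columns-unimodular u tiling (c + 1ℤ)) i)
             (sym (minor-recurrenceʸ (adjacent-columns-unimodular u tiling c) i)))

  columnMinor-recurrence : ∀ c j i →
    columnMinor u c (i - 1ℤ) (i + 1ℤ) * u i j ≡ u (i - 1ℤ) j + u (i + 1ℤ) j
  columnMinor-recurrence c j i = begin
    columnMinor u c (i - 1ℤ) (i + 1ℤ) * u i j
      ≡⟨ cong (_* u i j) (step-invariant⇒constant (λ c → columnMinor u c (i - 1ℤ) (i + 1ℤ))
                                                  (λ c → coefficient-step c i) c j) ⟩
    columnMinor u j (i - 1ℤ) (i + 1ℤ) * u i j
      ≡⟨ minor-recurrenceˣ (adjacent-columns-unimodular u tiling j) i ⟩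
    u (i - 1ℤ) j + u (i + 1ℤ) j ∎
    where open ≡-Reasoning

module _ (u : ℤ → ℤ → ℤ) (tiling : IsSL2Tiling u) (positive : TilingPositiveIntegral u) where

  private
    columnMinor-step : ∀ c k l → columnMinor u (c + 1ℤ) k l ≡ columnMinor u c k l
    columnMinor-step c = minor-shift {flip u c} {flip u (c + 1ℤ)} {flip u (c + 1ℤ + 1ℤ)}
                                     column-coefficient column-recurrence
      where
      c+1-1≡c : ∀ c → c + 1ℤ - 1ℤ ≡ c
      c+1-1≡c = solve-∀
      column-coefficient : ℤ
      column-coefficient = columnMinor (flip u) 0ℤ c (c + 1ℤ + 1ℤ)
      column-recurrence : ∀ i → column-coefficient * u i (c + 1ℤ) ≡ u i c + u i (c + 1ℤ + 1ℤ)
      column-recurrence i =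
        subst (λ c′ → columnMinor (flip u) 0ℤ c′ (c + 1ℤ + 1ℤ) * u i (c + 1ℤ) ≡ u i c′ + u i (c + 1ℤ + 1ℤ))
              (c+1-1≡c c)
              (columnMinor-recurrence (flip u) (flip-isSL2Tiling u tiling) (λ i j → positive j i) 0ℤ i (c + 1ℤ))

  columnMinor-independent : ∀ c c′ k l → columnMinor u c k l ≡ columnMinor u c′ k l
  columnMinor-independent c c′ k l =
    step-invariant⇒constant (λ c → columnMinor u c k l) (λ c → columnMinor-step c k l) c c′

row-frieze : ∀ m n u → IsSL2Tiling u → TilingPositiveIntegral u → TilingPeriodic m n u →
  ∃ λ v → IsInfiniteFrieze v × FriezePositiveIntegral v × FriezePeriodic m v ×
    (∀ j₀ i → v (i - 1ℤ) (i + 1ℤ) * u i j₀ ≡ u (i - 1ℤ) j₀ + u (i + 1ℤ) j₀)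
row-frieze m n u tiling positive periodic =
  columnMinor u 0ℤ ,
  minor-isInfiniteFrieze (adjacent-columns-unimodular u tiling 0ℤ) ,
  minor-positive (adjacent-columns-unimodular u tiling 0ℤ) (λ k → positive k 0ℤ) ,
  (λ k l _ → trans (columnMinor-independent u tiling positive 0ℤ (0ℤ + + n) (k + + m) (l + + m))
                   (columnMinor-periodic periodic 0ℤ k l)) ,
  columnMinor-recurrence u tiling positive 0ℤ

proposition6p1 : (m n : ℕ) → .{{NonZero m}} → .{{NonZero n}} →
    (u : ℤ → ℤ → ℤ) → IsSL2Tiling u → TilingPositiveIntegral u → TilingPeriodic m n u →
    (∃ λ v → IsInfiniteFrieze v × FriezePositiveIntegral v × FriezePeriodic m v ×
      (∀ j₀ i → v (i - 1ℤ) (i + 1ℤ) * u i j₀ ≡ u (i - 1ℤ) j₀ + u (i + 1ℤ) j₀))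
    ×
    (∃ λ w → IsInfiniteFrieze w × FriezePositiveIntegral w × FriezePeriodic n w ×
      (∀ i₀ j → w (j - 1ℤ) (j + 1ℤ) * u i₀ j ≡ u i₀ (j - 1ℤ) + u i₀ (j + 1ℤ)))
proposition6p1 m n u tiling positive periodic =
  row-frieze m n u tiling positive periodic ,
  row-frieze n m (flip u) (flip-isSL2Tiling u tiling) (λ i j → positive j i) (λ i j → periodic j i)
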